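{- Let $r,s$ be positive integers and let $f:\mathbb Z^+\to\{ -r,s\}$ be a function such that $|f([n])|=o(n)$ as $n\to\infty$. Then for every positive integer $k$ divisible by $r+s$, there are infinitely many $k$-blocks $B\subseteq\mathbb Z^+$ with $f(B)=0$.
   Context: $[n]=\{1,\ldots,n\}$; for $Y\subseteq\mathbb Z^+$ finite, $f(Y)=\sum_{y\in Y}f(y)$. A $k$-block is a set of $k$ consecutive integers. -}

module Defs where

open import Data.Nat using (ℕ; zero; suc; _+_; _*_; _≤_)
open import Data.Integer as ℤ using (ℤ; +_; -_; ∣_∣)
open import Data.Sum using (_⊎_)
open import Data.Product using (Σ; _×_; ∃-syntax)
open import Relation.Binary.PropositionalEquality using (_≡_)

blockSum : (ℕ → ℤ) → ℕ → ℕ → ℤ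
blockSum f a zero    = + 0
blockSum f a (suc k) = f a ℤ.+ blockSum f (suc a) k

prefixSum : (ℕ → ℤ) → ℕ → ℤ
prefixSum f n = blockSum f 1 n

ValuesIn : ℕ → ℕ → (ℕ → ℤ) → Set
ValuesIn r s f = ∀ x → 1 ≤ x → (f x ≡ - (+ r)) ⊎ (f x ≡ + s)

-- |f([n])| = o(n): for every ε = 1/m > 0 there is N with |f([n])| ≤ n/m for n ≥ N
LittleOhN : (ℕ → ℤ) → Set
LittleOhN g = ∀ m → 1 ≤ m → ∃[ N ] (∀ n → N ≤ n → ∣ g n ∣ * m ≤ n)

-- infinitely many k-blocks B ⊆ ℤ⁺ (B = {a,...,a+k-1}, a ≥ 1) with f(B) = 0;
-- blocks are determined by their least element, so: such starts are unbounded.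
InfManyZeroBlocks : (ℕ → ℤ) → ℕ → Set
InfManyZeroBlocks f k = ∀ M → ∃[ a ] (M ≤ a × 1 ≤ a × blockSum f a k ≡ + 0)

-- Write k = q(r + s). Since f x = (r + s)·e x − r with e x ∈ {0, 1}, the sum over a k-block is
-- (r + s)(h − q r), where h counts the points of the block at which f equals s, and h changes
-- by at most 1 when the block slides one step. If from some point on every k-block had positive
-- sum, adding j consecutive disjoint blocks would make |f([n])| grow linearly, contradicting
-- |f([n])| = o(n); the same holds for negative sums (apply this to −f). So beyond any M there are
-- blocks with f(B) ≤ 0 and with f(B) ≥ 0, and a discrete intermediate value argument on h between
-- them gives a block with h = q r, that is f(B) = 0.
module Submission where

open import Defs
open import Data.Nat using (ℕ; zero; suc; _+_; _*_; _∸_; _⊓_; _≤_; _≟_; z≤n; s≤s; NonZero; >-nonZero)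
open import Data.Nat.Properties
open import Data.Nat.Divisibility using (_∣_; divides)
open import Data.Integer as ℤ using (ℤ; +_; 0ℤ; ∣_∣)
import Data.Integer.Properties as ℤₚ
open import Data.Integer.Tactic.RingSolver using (solve-∀)
import Data.Nat.Tactic.RingSolver as ℕ-Ring
open import Data.Product using (_×_; _,_; ∃-syntax; map₁; map₂)
open import Data.Sum using (_⊎_; inj₁; inj₂)
open import Data.Empty using (⊥-elim)
open import Function using (_∘_)
open import Relation.Nullary using (yes; no)
open import Relation.Binary.PropositionalEquality

blockSum-++ : ∀ f a m n → blockSum f a (m + n) ≡ blockSum f a m ℤ.+ blockSum f (a + m) n
blockSum-++ f a zero    n rewrite +-identityʳ a = sym (ℤₚ.+-identityˡ _)
blockSum-++ f a (suc m) n rewrite blockSum-++ f (suc a) m n | +-suc a m = sym (ℤₚ.+-assoc (f a) _ _)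

blockSum-neg : ∀ f a n → blockSum (ℤ.-_ ∘ f) a n ≡ ℤ.- blockSum f a n
blockSum-neg f a zero    = refl
blockSum-neg f a (suc n) rewrite blockSum-neg f (suc a) n = sym (ℤₚ.neg-distrib-+ (f a) _)

littleOh-prefixSum-neg : ∀ {f} → LittleOhN (prefixSum f) → LittleOhN (prefixSum (ℤ.-_ ∘ f))
littleOh-prefixSum-neg {f} o m 1≤m =
  map₂ (λ bound n N≤n → subst (λ x → x * m ≤ n) (sym (∣prefixSum-neg∣ n)) (bound n N≤n)) (o m 1≤m)
  where
  ∣prefixSum-neg∣ : ∀ n → ∣ prefixSum (ℤ.-_ ∘ f) n ∣ ≡ ∣ prefixSum f n ∣
  ∣prefixSum-neg∣ n = trans (cong ∣_∣ (blockSum-neg f 1 n)) (ℤₚ.∣-i∣≡∣i∣ (prefixSum f n))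

nonPositiveBlock⊎linearGrowth : ∀ f a k j →
  (∃[ i ] blockSum f (a + i * k) k ℤ.≤ 0ℤ) ⊎ (+ j ℤ.≤ blockSum f a (j * k))
nonPositiveBlock⊎linearGrowth f a k zero = inj₂ ℤₚ.≤-refl
nonPositiveBlock⊎linearGrowth f a k (suc j) with nonPositiveBlock⊎linearGrowth f a k j
... | inj₁ found = inj₁ found
... | inj₂ j≤sum with blockSum f (a + j * k) k ℤₚ.≤? 0ℤ
...   | yes ≤0 = inj₁ (j , ≤0)
...   | no ≰0 =
  inj₂ (subst (+ suc j ℤ.≤_) sums≡ (ℤₚ.+-mono-≤ (ℤₚ.i<j⇒suc[i]≤j (ℤₚ.≰⇒> ≰0)) j≤sum))
  where
  sums≡ : blockSum f (a + j * k) k ℤ.+ blockSum f a (j * k) ≡ blockSum f a (suc j * k)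
  sums≡ = begin
    blockSum f (a + j * k) k ℤ.+ blockSum f a (j * k) ≡⟨ ℤₚ.+-comm (blockSum f (a + j * k) k) _ ⟩
    blockSum f a (j * k) ℤ.+ blockSum f (a + j * k) k ≡⟨ blockSum-++ f a (j * k) k ⟨
    blockSum f a (j * k + k)                          ≡⟨ cong (blockSum f a) (+-comm (j * k) k) ⟩
    blockSum f a (suc j * k)                          ∎
    where open ≡-Reasoning

x+y-x≡y : ∀ x y → x ℤ.+ y ℤ.- x ≡ y
x+y-x≡y = solve-∀

[x-y]+[z-w]≡[x+z]-[y+w] : ∀ x y z w → (x ℤ.- y) ℤ.+ (z ℤ.- w) ≡ (x ℤ.+ z) ℤ.- (y ℤ.+ w)
[x-y]+[z-w]≡[x+z]-[y+w] = solve-∀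

+j≤y⇒j≤∣x+y∣+∣x∣ : ∀ {j} x y → + j ℤ.≤ y → j ≤ ∣ x ℤ.+ y ∣ + ∣ x ∣
+j≤y⇒j≤∣x+y∣+∣x∣ x (+ n) (ℤ.+≤+ j≤n) =
  ≤-trans j≤n (subst (_≤ ∣ x ℤ.+ + n ∣ + ∣ x ∣) (cong ∣_∣ (x+y-x≡y x (+ n)))
                     (ℤₚ.∣i-j∣≤∣i∣+∣j∣ (x ℤ.+ + n) x))

linear≤sublinear⇒bounded : ∀ {j A c n₀ k} → j ≤ A + c → A * suc k ≤ n₀ + j * k → j ≤ n₀ + c * suc k
linear≤sublinear⇒bounded {j} {A} {c} {n₀} {k} j≤A+c A[1+k]≤ = +-cancelʳ-≤ (j * k) j (n₀ + c * suc k) (begin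
  j + j * k                    ≡⟨ *-suc j k ⟨
  j * suc k                    ≤⟨ *-monoˡ-≤ (suc k) j≤A+c ⟩
  (A + c) * suc k              ≡⟨ *-distribʳ-+ (suc k) A c ⟩
  A * suc k + c * suc k        ≤⟨ +-monoˡ-≤ (c * suc k) A[1+k]≤ ⟩
  n₀ + j * k + c * suc k       ≡⟨ +-assoc n₀ (j * k) (c * suc k) ⟩
  n₀ + (j * k + c * suc k)     ≡⟨ cong (λ x → n₀ + x) (+-comm (j * k) (c * suc k)) ⟩
  n₀ + (c * suc k + j * k)     ≡⟨ +-assoc n₀ (c * suc k) (j * k) ⟨
  n₀ + c * suc k + j * k       ∎)
  where open ≤-Reasoning

nonPositiveBlock : ∀ {f} → LittleOhN (prefixSum f) → ∀ k .{{_ : NonZero k}} → ∀ M →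
  ∃[ a ] (M ≤ a × 1 ≤ a × blockSum f a k ℤ.≤ 0ℤ)
nonPositiveBlock {f} o k M with o (suc k) (s≤s z≤n)
... | N , sublinear = choose (nonPositiveBlock⊎linearGrowth f (suc M) k j)
  where
  -- Large enough that j positive blocks after M would push |f([M + j k])| above (M + j k)/(k + 1).
  j : ℕ
  j = suc (M + ∣ prefixSum f M ∣ * suc k + N)

  n : ℕ
  n = M + j * k

  N≤n : N ≤ n
  N≤n = ≤-trans (≤-trans (m≤n+m N _) (n≤1+n _)) (≤-trans (m≤m*n j k) (m≤n+m (j * k) M))

  choose : (∃[ i ] blockSum f (suc M + i * k) k ℤ.≤ 0ℤ) ⊎ (+ j ℤ.≤ blockSum f (suc M) (j * k)) →
           ∃[ a ] (M ≤ a × 1 ≤ a × blockSum f a k ℤ.≤ 0ℤ)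
  choose (inj₁ (i , ≤0)) = suc M + i * k , ≤-trans (n≤1+n M) (m≤m+n _ _) , s≤s z≤n , ≤0
  choose (inj₂ j≤) = ⊥-elim (<⇒≱ (s≤s (m≤m+n _ N)) j≤M+∣PM∣[1+k])
    where
    j≤∣Pn∣+∣PM∣ : j ≤ ∣ prefixSum f n ∣ + ∣ prefixSum f M ∣
    j≤∣Pn∣+∣PM∣ = subst (λ P → j ≤ ∣ P ∣ + _) (sym (blockSum-++ f 1 M (j * k)))
                    (+j≤y⇒j≤∣x+y∣+∣x∣ (prefixSum f M) _ j≤)

    j≤M+∣PM∣[1+k] : j ≤ M + ∣ prefixSum f M ∣ * suc k
    j≤M+∣PM∣[1+k] = linear≤sublinear⇒bounded {A = ∣ prefixSum f n ∣} j≤∣Pn∣+∣PM∣ (sublinear n N≤n)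

nonNegativeBlock : ∀ {f} → LittleOhN (prefixSum f) → ∀ k .{{_ : NonZero k}} → ∀ M →
  ∃[ a ] (M ≤ a × 1 ≤ a × 0ℤ ℤ.≤ blockSum f a k)
nonNegativeBlock {f} o k M with nonPositiveBlock (littleOh-prefixSum-neg o) k M
... | a , M≤a , 1≤a , ≤0 = a , M≤a , 1≤a , ℤₚ.neg-cancel-≤ (subst (ℤ._≤ 0ℤ) (blockSum-neg f a k) ≤0)

blockSumℕ : (ℕ → ℕ) → ℕ → ℕ → ℕ
blockSumℕ h a zero    = 0
blockSumℕ h a (suc n) = h a + blockSumℕ h (suc a) n

blockSumℕ-slide : ∀ h a n → blockSumℕ h a n + h (a + n) ≡ h a + blockSumℕ h (suc a) n
blockSumℕ-slide h a zero    rewrite +-identityʳ a = +-comm 0 (h a)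
blockSumℕ-slide h a (suc n)
  rewrite +-assoc (h a) (blockSumℕ h (suc a) n) (h (a + suc n)) | +-suc a n | blockSumℕ-slide h (suc a) n = refl

module _ {h : ℕ → ℕ} (h≤1 : ∀ x → h x ≤ 1) where

  blockSumℕ-next≤suc : ∀ a n → blockSumℕ h (suc a) n ≤ suc (blockSumℕ h a n)
  blockSumℕ-next≤suc a n = begin
    blockSumℕ h (suc a) n         ≤⟨ m≤n+m _ (h a) ⟩
    h a + blockSumℕ h (suc a) n   ≡⟨ blockSumℕ-slide h a n ⟨
    blockSumℕ h a n + h (a + n)   ≤⟨ +-monoʳ-≤ (blockSumℕ h a n) (h≤1 (a + n)) ⟩
    blockSumℕ h a n + 1           ≡⟨ +-comm (blockSumℕ h a n) 1 ⟩
    suc (blockSumℕ h a n)         ∎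
    where open ≤-Reasoning

  blockSumℕ≤suc-next : ∀ a n → blockSumℕ h a n ≤ suc (blockSumℕ h (suc a) n)
  blockSumℕ≤suc-next a n = begin
    blockSumℕ h a n               ≤⟨ m≤m+n _ (h (a + n)) ⟩
    blockSumℕ h a n + h (a + n)   ≡⟨ blockSumℕ-slide h a n ⟩
    h a + blockSumℕ h (suc a) n   ≤⟨ +-monoˡ-≤ (blockSumℕ h (suc a) n) (h≤1 a) ⟩
    suc (blockSumℕ h (suc a) n)   ∎
    where open ≤-Reasoning

module UnitSteps (g : ℕ → ℕ) (up : ∀ t → g (suc t) ≤ suc (g t)) (down : ∀ t → g t ≤ suc (g (suc t))) where

  climb : ∀ {v} t d → g t ≤ v → v ≤ g (t + d) → ∃[ c ] (t ≤ c × g c ≡ v)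
  climb t zero gt≤v v≤g rewrite +-identityʳ t = t , ≤-refl , ≤-antisym gt≤v v≤g
  climb {v} t (suc d) gt≤v v≤g with g t ≟ v
  ... | yes gt≡v = t , ≤-refl , gt≡v
  ... | no gt≢v = map₂ (map₁ (≤-trans (n≤1+n t)))
                    (climb (suc t) d (≤-trans (up t) (≤∧≢⇒< gt≤v gt≢v))
                      (subst (λ u → v ≤ g u) (+-suc t d) v≤g))

  descend : ∀ {v} t d → v ≤ g t → g (t + d) ≤ v → ∃[ c ] (t ≤ c × g c ≡ v)
  descend t zero v≤gt g≤v rewrite +-identityʳ t = t , ≤-refl , ≤-antisym g≤v v≤gt
  descend {v} t (suc d) v≤gt g≤v with g t ≟ v
  ... | yes gt≡v = t , ≤-refl , gt≡v
  ... | no gt≢v = map₂ (map₁ (≤-trans (n≤1+n t)))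
                    (descend (suc t) d (≤-pred (≤-trans (≤∧≢⇒< v≤gt (≢-sym gt≢v)) (down t)))
                      (subst (λ u → g u ≤ v) (+-suc t d) g≤v))

  intermediateValue : ∀ {v} t u → g t ≤ v → v ≤ g u → ∃[ c ] (t ⊓ u ≤ c × g c ≡ v)
  intermediateValue {v} t u gt≤v v≤gu with ≤-total t u
  ... | inj₁ t≤u = map₂ (map₁ (≤-trans (m⊓n≤m t u)))
                     (climb t (u ∸ t) gt≤v (subst (λ w → v ≤ g w) (sym (m+[n∸m]≡n t≤u)) v≤gu))
  ... | inj₂ u≤t = map₂ (map₁ (≤-trans (m⊓n≤n t u)))
                     (descend u (t ∸ u) v≤gu (subst (λ w → g w ≤ v) (sym (m+[n∸m]≡n u≤t)) gt≤v))

indicator : (ℕ → ℤ) → ℤ → ℕ → ℕ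
indicator f v x with f x ℤ.≟ v
... | yes _ = 1
... | no  _ = 0

indicator≤1 : ∀ f v x → indicator f v x ≤ 1
indicator≤1 f v x with f x ℤ.≟ v
... | yes _ = ≤-refl
... | no  _ = z≤n

module _ {r s : ℕ} {f : ℕ → ℤ} (f∈ : ValuesIn r s f) where

  private
    hits : ℕ → ℕ → ℕ
    hits = blockSumℕ (indicator f (+ s))

  valuesIn⇒affine : ∀ {x} → 1 ≤ x → f x ≡ + ((r + s) * indicator f (+ s) x) ℤ.- + r
  valuesIn⇒affine {x} 1≤x with f x ℤ.≟ + s | f∈ x 1≤x
  ... | yes fx≡s | _        = trans fx≡s (sym (begin
    + ((r + s) * 1) ℤ.- + r   ≡⟨ cong (λ t → + t ℤ.- + r) (*-identityʳ (r + s)) ⟩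
    + r ℤ.+ + s ℤ.- + r       ≡⟨ x+y-x≡y (+ r) (+ s) ⟩
    + s                       ∎))
    where open ≡-Reasoning
  ... | no fx≢s  | inj₂ fx≡s = ⊥-elim (fx≢s fx≡s)
  ... | no _     | inj₁ fx≡-r rewrite *-zeroʳ (r + s) = trans fx≡-r (sym (ℤₚ.+-identityˡ _))

  blockSum≡affine : ∀ {a} → 1 ≤ a → ∀ n → blockSum f a n ≡ + ((r + s) * hits a n) ℤ.- + (n * r)
  blockSum≡affine _ zero rewrite *-zeroʳ (r + s) = refl
  blockSum≡affine {a} 1≤a (suc n) = begin
    f a ℤ.+ blockSum f (suc a) n
      ≡⟨ cong₂ ℤ._+_ (valuesIn⇒affine 1≤a) (blockSum≡affine (s≤s z≤n) n) ⟩
    (+ ((r + s) * hit) ℤ.- + r) ℤ.+ (+ ((r + s) * rest) ℤ.- + (n * r))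
      ≡⟨ [x-y]+[z-w]≡[x+z]-[y+w] (+ ((r + s) * hit)) (+ r) (+ ((r + s) * rest)) (+ (n * r)) ⟩
    + ((r + s) * hit + (r + s) * rest) ℤ.- + (suc n * r)
      ≡⟨ cong (λ t → + t ℤ.- + (suc n * r)) (*-distribˡ-+ (r + s) hit rest) ⟨
    + ((r + s) * hits a (suc n)) ℤ.- + (suc n * r)
      ∎
    where
    open ≡-Reasoning
    hit rest : ℕ
    hit = indicator f (+ s) a
    rest = hits (suc a) n

  blockSum≡scaledHits : ∀ q {a} → 1 ≤ a →
    blockSum f a (q * (r + s)) ≡ + ((r + s) * hits a (q * (r + s))) ℤ.- + ((r + s) * (q * r))
  blockSum≡scaledHits q {a} 1≤a =
    trans (blockSum≡affine 1≤a (q * (r + s)))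
          (cong (λ t → + ((r + s) * hits a (q * (r + s))) ℤ.- + t) (qRr≡Rqr q (r + s) r))
    where
    qRr≡Rqr : ∀ q R r → q * R * r ≡ R * (q * r)
    qRr≡Rqr = ℕ-Ring.solve-∀

  nonPositiveBlock⇒hits≤ : ∀ q .{{_ : NonZero (r + s)}} {a} → 1 ≤ a →
    blockSum f a (q * (r + s)) ℤ.≤ 0ℤ → hits a (q * (r + s)) ≤ q * r
  nonPositiveBlock⇒hits≤ q 1≤a ≤0 = *-cancelˡ-≤ (r + s)
    (ℤₚ.drop‿+≤+ (ℤₚ.i-j≤0⇒i≤j (subst (ℤ._≤ 0ℤ) (blockSum≡scaledHits q 1≤a) ≤0)))

  nonNegativeBlock⇒≤hits : ∀ q .{{_ : NonZero (r + s)}} {b} → 1 ≤ b →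
    0ℤ ℤ.≤ blockSum f b (q * (r + s)) → q * r ≤ hits b (q * (r + s))
  nonNegativeBlock⇒≤hits q 1≤b 0≤ = *-cancelˡ-≤ (r + s)
    (ℤₚ.drop‿+≤+ (ℤₚ.0≤i-j⇒j≤i (subst (0ℤ ℤ.≤_) (blockSum≡scaledHits q 1≤b) 0≤)))

  hits≡⇒zeroBlock : ∀ q {c} → 1 ≤ c → hits c (q * (r + s)) ≡ q * r → blockSum f c (q * (r + s)) ≡ 0ℤ
  hits≡⇒zeroBlock q {c} 1≤c hits≡ = begin
    blockSum f c (q * (r + s))                                    ≡⟨ blockSum≡scaledHits q 1≤c ⟩
    + ((r + s) * hits c (q * (r + s))) ℤ.- + ((r + s) * (q * r))
      ≡⟨ cong (λ t → + ((r + s) * t) ℤ.- + ((r + s) * (q * r))) hits≡ ⟩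
    + ((r + s) * (q * r)) ℤ.- + ((r + s) * (q * r))               ≡⟨ ℤₚ.+-inverseʳ (+ ((r + s) * (q * r))) ⟩
    0ℤ                                                            ∎
    where open ≡-Reasoning

  zeroBlock-between : ∀ q .{{_ : NonZero (r + s)}} {a b} → 1 ≤ a → 1 ≤ b →
    blockSum f a (q * (r + s)) ℤ.≤ 0ℤ → 0ℤ ℤ.≤ blockSum f b (q * (r + s)) →
    ∃[ c ] (a ⊓ b ≤ c × blockSum f c (q * (r + s)) ≡ 0ℤ)
  zeroBlock-between q {a} {b} 1≤a 1≤b ≤0 0≤ =
    let c , a⊓b≤c , hits≡ = intermediateValue a b (nonPositiveBlock⇒hits≤ q 1≤a ≤0)
                                                  (nonNegativeBlock⇒≤hits q 1≤b 0≤)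
    in  c , a⊓b≤c , hits≡⇒zeroBlock q (≤-trans (⊓-glb 1≤a 1≤b) a⊓b≤c) hits≡
    where
    k : ℕ
    k = q * (r + s)
    open UnitSteps (λ t → hits t k)
      (λ t → blockSumℕ-next≤suc (indicator≤1 f (+ s)) t k)
      (λ t → blockSumℕ≤suc-next (indicator≤1 f (+ s)) t k)

theorem2p16 : (r s : ℕ) → 1 ≤ r → 1 ≤ s → (f : ℕ → ℤ) → ValuesIn r s f →
    LittleOhN (prefixSum f) →
    (k : ℕ) → 1 ≤ k → (r + s) ∣ k → InfManyZeroBlocks f k
theorem2p16 r s 1≤r _ f f∈ o .(q * (r + s)) 1≤k (divides q refl) M =
  let instance
        k≢0 : NonZero (q * (r + s))
        k≢0 = >-nonZero 1≤k
        r+s≢0 : NonZero (r + s)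
        r+s≢0 = >-nonZero (≤-trans 1≤r (m≤m+n r s))
      a , M≤a , 1≤a , ≤0 = nonPositiveBlock o (q * (r + s)) M
      b , M≤b , 1≤b , 0≤ = nonNegativeBlock o (q * (r + s)) M
      c , a⊓b≤c , zero-sum = zeroBlock-between f∈ q 1≤a 1≤b ≤0 0≤
  in  c , ≤-trans (⊓-glb M≤a M≤b) a⊓b≤c , ≤-trans (⊓-glb 1≤a 1≤b) a⊓b≤c , zero-sum
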